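{- Let $R_1$ and $R_2$ be rectangular grids of dimensions $(m_1 \times n_1)$ and $(m_2 \times n_2)$ respectively. Suppose $c_1$ is a partial coloring of $R_1$ that realizes every color pair in a set $A$ of pairs of colors from $[k_0]$. If there exists $k \in \mathbb{N}$ such that $k m_1 \le m_2$ and $n_1 + (k-1) \le k n_2$, then there is a partial coloring $c_2$ of $R_2$ that also realizes every color pair in $A$.
   Context: For $m,n \in \mathbb{N}$, the rectangular grid of dimensions $(m \times n)$ is the graph $R_{m\times n}$ with vertex set $\{(i,j) \in \mathbb{Z}^2 : 1 \le i \le m,\ 1 \le j \le n\}$ and $(i_1,j_1) \sim (i_2,j_2)$ iff $|i_1-i_2|+|j_1-j_2|=1$. A partial coloring of a graph $G$ is an assignment $c: V(H) \to [k]$ of colors to the vertices of some subgraph $H$ of $G$ (some vertices may be left uncolored). A (partial) coloring $c$ realizes the pair of colors $\{i,j\}$ if there is an edge $\{v,w\} \in E(G)$ with both endpoints colored and $c(v)=i$, $c(w)=j$. -}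

module Defs where

open import Data.Nat using (ℕ; _+_; _∸_)
open import Data.Fin using (Fin; toℕ)
open import Data.Product using (_×_; Σ; ∃-syntax; _,_)
open import Data.Maybe using (Maybe; just)
open import Relation.Binary.PropositionalEquality using (_≡_)

∣_-_∣ : ℕ → ℕ → ℕ
∣ a - b ∣ = (a ∸ b) + (b ∸ a)

-- vertices of the rectangular grid R_{m×n} (coordinates shifted to start at 0)
Grid : ℕ → ℕ → Set
Grid m n = Fin m × Fin n

Adj : ∀ {m n} → Grid m n → Grid m n → Set
Adj (i₁ , j₁) (i₂ , j₂) = ∣ toℕ i₁ - toℕ i₂ ∣ + ∣ toℕ j₁ - toℕ j₂ ∣ ≡ 1

-- partial coloring of R_{m×n} with colors in [k₀]: uncolored vertices map to nothing
PartialColoring : ℕ → ℕ → ℕ → Set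
PartialColoring k₀ m n = Grid m n → Maybe (Fin k₀)

Realizes : ∀ {k₀ m n} → PartialColoring k₀ m n → Fin k₀ → Fin k₀ → Set
Realizes {m = m} {n} c a b =
  ∃[ v ] ∃[ w ] (Adj {m} {n} v w × c v ≡ just a × c w ≡ just b)

RealizesAll : ∀ {k₀ m n} → PartialColoring k₀ m n → (Fin k₀ → Fin k₀ → Set) → Set
RealizesAll c A = ∀ a b → A a b → Realizes c a b

module Submission where

-- Cut the m₁ × n₁ colouring c₁ into k vertical windows of
-- width n₂, the s-th one starting at column s · (n₂ ∸ 1), so that
-- consecutive windows share one column, and stack them on top of each
-- other in R₂: the block of rows s · m₁ … s · m₁ + m₁ ∸ 1 of R₂ shows
-- window s.  The hypothesis n₁ + (k ∸ 1) ≤ k · n₂ says that the windows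
-- cover all n₁ columns; since they overlap, every edge of R₁ (horizontal
-- or vertical) lies inside a single window, hence reappears inside one
-- block of R₂ with the same colours at its ends.  The hypothesis
-- k · m₁ ≤ m₂ says that the k blocks fit into R₂.

open import Defs
open import Data.Nat using (ℕ; zero; suc; _+_; _*_; _∸_; _≤_; _<_; _/_; _%_; NonZero; _<?_; z≤n; s≤s)
open import Data.Nat.Properties
open import Data.Nat.DivMod
open import Data.Nat.Divisibility using (n∣m*n)
open import Data.Nat.Solver using (module +-*-Solver)
open import Data.Fin using (Fin; toℕ; fromℕ<)
open import Data.Fin.Properties using (toℕ-injective; toℕ-fromℕ<; fromℕ<-toℕ; toℕ<n)
open import Data.Product using (Σ; ∃-syntax; _×_; _,_; proj₁; proj₂)
open import Data.Sum using (inj₁; inj₂)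
open import Data.Maybe using (Maybe; nothing)
open import Data.Empty using (⊥-elim)
open import Relation.Nullary using (yes; no)
open import Relation.Nullary.Negation using (contradiction)
open import Relation.Binary.PropositionalEquality

dist-comm : ∀ x y → ∣ x - y ∣ ≡ ∣ y - x ∣
dist-comm x y = +-comm (x ∸ y) (y ∸ x)

dist-+ˡ : ∀ a x y → ∣ a + x - a + y ∣ ≡ ∣ x - y ∣
dist-+ˡ a x y = cong₂ _+_ ([m+n]∸[m+o]≡n∸o a x y) ([m+n]∸[m+o]≡n∸o a y x)

dist-+ʳ : ∀ a x y → ∣ x + a - y + a ∣ ≡ ∣ x - y ∣
dist-+ʳ a x y = trans (cong₂ ∣_-_∣ (+-comm x a) (+-comm y a)) (dist-+ˡ a x y)

dist-∸ : ∀ a x y → a ≤ x → a ≤ y → ∣ x ∸ a - y ∸ a ∣ ≡ ∣ x - y ∣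
dist-∸ a x y a≤x a≤y =
  sym (trans (cong₂ ∣_-_∣ (sym (m+[n∸m]≡n a≤x)) (sym (m+[n∸m]≡n a≤y)))
             (dist-+ˡ a (x ∸ a) (y ∸ a)))

dist≤1⇒≤suc : ∀ x y → ∣ x - y ∣ ≤ 1 → y ≤ suc x
dist≤1⇒≤suc x y gap = begin
  y             ≤⟨ m≤n+m∸n y x ⟩
  x + (y ∸ x)   ≤⟨ +-monoʳ-≤ x (≤-trans (m≤n+m (y ∸ x) (x ∸ y)) gap) ⟩
  x + 1         ≡⟨ +-comm x 1 ⟩
  suc x         ∎
  where open ≤-Reasoning

column-gap : ∀ {m n} (v w : Grid m n) → Adj {m} {n} v w →
  ∣ toℕ (proj₂ v) - toℕ (proj₂ w) ∣ ≤ 1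
column-gap (i₁ , j₁) (i₂ , j₂) adj =
  ≤-trans (m≤n+m ∣ toℕ j₁ - toℕ j₂ ∣ ∣ toℕ i₁ - toℕ i₂ ∣) (≤-reflexive adj)

Simulates : ∀ {k₀ m₁ n₁ m₂ n₂} → PartialColoring k₀ m₁ n₁ → PartialColoring k₀ m₂ n₂ → Set
Simulates {m₁ = m₁} {n₁} {m₂} {n₂} c₁ c₂ =
  ∀ v w → Adj {m₁} {n₁} v w →
  ∃[ v′ ] ∃[ w′ ] (Adj {m₂} {n₂} v′ w′ × c₂ v′ ≡ c₁ v × c₂ w′ ≡ c₁ w)

simulates-realizesAll : ∀ {k₀ m₁ n₁ m₂ n₂} {c₁ : PartialColoring k₀ m₁ n₁}
  {c₂ : PartialColoring k₀ m₂ n₂} (A : Fin k₀ → Fin k₀ → Set) →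
  Simulates c₁ c₂ → RealizesAll c₁ A → RealizesAll c₂ A
simulates-realizesAll A sim realized a b Aab with realized a b Aab
... | v , w , adj , cv , cw with sim v w adj
...   | v′ , w′ , adj′ , cv′ , cw′ = v′ , w′ , adj′ , trans cv′ cv , trans cw′ cw

rowless-simulated : ∀ {k₀ n₁ m₂ n₂} (c₁ : PartialColoring k₀ 0 n₁)
  (c₂ : PartialColoring k₀ m₂ n₂) → Simulates c₁ c₂
rowless-simulated c₁ c₂ (() , _) w adj

-- (3) Windows.  Window s of width w occupies the columns j with
-- s · (w ∸ 1) ≤ j < s · (w ∸ 1) + w; consecutive windows share a column.
InWindow : ℕ → ℕ → ℕ → Set
InWindow w s j = s * (w ∸ 1) ≤ j × j < s * (w ∸ 1) + w

-- If the first k′ + 1 windows cover the columns below n₁ (which is what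
-- n₁ + k′ ≤ (k′ + 1) · w expresses), then for columns with j′ ≤ j + 1 and
-- j′ < n₁ one of them starts at or before j and ends after j′.
window-start : ∀ n₁ k′ w → n₁ + k′ ≤ suc k′ * w → ∀ {j j′} → j′ ≤ suc j → j′ < n₁ →
  ∃[ s ] (s < suc k′ × s * (w ∸ 1) ≤ j × j′ < s * (w ∸ 1) + w)
window-start n₁ k′ zero cover {j′ = j′} _ j′<n₁ = ⊥-elim (n≮0 (<-≤-trans j′<n₁ n₁≤0))
  where
  n₁≤0 : n₁ ≤ 0
  n₁≤0 = ≤-trans (m≤m+n n₁ k′) (≤-trans cover (≤-reflexive (*-zeroʳ k′)))
window-start n₁ k′ (suc zero) cover _ j′<n₁ = 0 , s≤s z≤n , z≤n , ≤-trans j′<n₁ n₁≤1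
  where
  n₁≤1 : n₁ ≤ 1
  n₁≤1 = +-cancelʳ-≤ k′ n₁ 1 (≤-trans cover (≤-reflexive (cong suc (*-identityʳ k′))))
window-start n₁ k′ (suc d@(suc _)) cover {j} {j′} j′≤sj j′<n₁ with j / d <? suc k′
... | yes q<k = j / d , q<k , m/n*n≤m j d , j′-before-next
  where
  j′-before-next : j′ < j / d * d + suc d
  j′-before-next = begin-strict
    j′                      ≤⟨ j′≤sj ⟩
    suc j                   ≡⟨ cong suc (m≡m%n+[m/n]*n j d) ⟩
    suc (j % d + j / d * d) ≤⟨ +-monoˡ-≤ (j / d * d) (m%n<n j d) ⟩
    d + j / d * d           ≡⟨ +-comm d (j / d * d) ⟩
    j / d * d + d           <⟨ +-monoʳ-< (j / d * d) (n<1+n d) ⟩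
    j / d * d + suc d       ∎
    where open ≤-Reasoning
... | no q≮k = k′ , n<1+n k′ , last-starts-before , ≤-trans j′<n₁ n₁≤end
  where
  open +-*-Solver
  last-starts-before : k′ * d ≤ j
  last-starts-before = ≤-trans (*-monoˡ-≤ d (≤-trans (n≤1+n k′) (≮⇒≥ q≮k))) (m/n*n≤m j d)
  n₁≤end : n₁ ≤ k′ * d + suc d
  n₁≤end = +-cancelʳ-≤ k′ n₁ _ (≤-trans cover (≤-reflexive
    (solve 2 (λ d k → (con 1 :+ k) :* (con 1 :+ d) := (k :* d :+ (con 1 :+ d)) :+ k)
           refl d k′)))

window-covers : ∀ n₁ k′ w → n₁ + k′ ≤ suc k′ * w → ∀ {x y} → ∣ x - y ∣ ≤ 1 →
  x < n₁ → y < n₁ → ∃[ s ] (s < suc k′ × InWindow w s x × InWindow w s y)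
window-covers n₁ k′ w cover {x} {y} gap x<n₁ y<n₁ with ≤-total x y
... | inj₁ x≤y with window-start n₁ k′ w cover (dist≤1⇒≤suc x y gap) y<n₁
...   | s , s<k , lo , hi = s , s<k , (lo , ≤-<-trans x≤y hi) , (≤-trans lo x≤y , hi)
window-covers n₁ k′ w cover {x} {y} gap x<n₁ y<n₁ | inj₂ y≤x
  with window-start n₁ k′ w cover (dist≤1⇒≤suc y x (subst (_≤ 1) (dist-comm x y) gap)) x<n₁
... | s , s<k , lo , hi = s , s<k , (≤-trans lo y≤x , hi) , (lo , ≤-<-trans y≤x hi)

-- (4) Rows of R₂ grouped into blocks of m rows: row i + s · m (with i < m)
-- is row i of block s.
block-offset : ∀ {m} .{{_ : NonZero m}} {i} s → i < m → (i + s * m) % m ≡ i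
block-offset {m} {i} s i<m = trans ([m+kn]%n≡m%n i s m) (m<n⇒m%n≡m i<m)

block-index : ∀ {m} .{{_ : NonZero m}} {i} s → i < m → (i + s * m) / m ≡ s
block-index {m} {i} s i<m = begin
  (i + s * m) / m     ≡⟨ +-distrib-/-∣ʳ i (n∣m*n s) ⟩
  i / m + s * m / m   ≡⟨ cong₂ _+_ (m<n⇒m/n≡0 i<m) (m*n/n≡m s m) ⟩
  s                   ∎
  where open ≡-Reasoning

module Stacking {k₀ m n₁ m₂ n₂ : ℕ} .{{_ : NonZero m}} (k′ : ℕ)
    (c₁ : PartialColoring k₀ m n₁)
    (rows-fit : suc k′ * m ≤ m₂) (windows-cover : n₁ + k′ ≤ suc k′ * n₂) where

  stride : ℕ
  stride = n₂ ∸ 1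

  -- c₁ read at an arbitrary column; columns beyond R₁ are uncoloured.
  extend : Fin m → ℕ → Maybe (Fin k₀)
  extend i j with j <? n₁
  ... | yes j<n₁ = c₁ (i , fromℕ< j<n₁)
  ... | no _     = nothing

  extend-spec : ∀ i (j : Fin n₁) → extend i (toℕ j) ≡ c₁ (i , j)
  extend-spec i j with toℕ j <? n₁
  ... | yes j<n₁ = cong (λ j′ → c₁ (i , j′)) (fromℕ<-toℕ j j<n₁)
  ... | no  j≮n₁ = contradiction (toℕ<n j) j≮n₁

  stacked : PartialColoring k₀ m₂ n₂
  stacked (r , c) = extend (fromℕ< (m%n<n (toℕ r) m)) (toℕ r / m * stride + toℕ c)

  place : ∀ s → s < suc k′ → (v : Grid m n₁) → InWindow n₂ s (toℕ (proj₂ v)) →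
    Grid m₂ n₂
  place s s<k (i , j) (lo , hi) = fromℕ< row<m₂ , fromℕ< col<n₂
    where
    row<m₂ : toℕ i + s * m < m₂
    row<m₂ = ≤-trans (+-monoˡ-≤ (s * m) (toℕ<n i)) (≤-trans (*-monoˡ-≤ m s<k) rows-fit)
    col<n₂ : toℕ j ∸ s * stride < n₂
    col<n₂ = subst (toℕ j ∸ s * stride <_) (m+n∸m≡n (s * stride) n₂) (∸-monoˡ-< hi lo)

  place-row : ∀ s s<k v win → toℕ (proj₁ (place s s<k v win)) ≡
    toℕ (proj₁ v) + s * m
  place-row s s<k (i , j) win = toℕ-fromℕ< _

  place-col : ∀ s s<k v win → toℕ (proj₂ (place s s<k v win)) ≡
    toℕ (proj₂ v) ∸ s * stride
  place-col s s<k (i , j) win = toℕ-fromℕ< _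

  stacked-place : ∀ s s<k v win → stacked (place s s<k v win) ≡ c₁ v
  stacked-place s s<k v@(i , j) win@(lo , _) =
    trans (cong₂ extend same-row same-col) (extend-spec i j)
    where
    r : ℕ
    r = toℕ (proj₁ (place s s<k v win))
    same-row : fromℕ< (m%n<n r m) ≡ i
    same-row = toℕ-injective (begin
      toℕ (fromℕ< (m%n<n r m)) ≡⟨ toℕ-fromℕ< (m%n<n r m) ⟩
      r % m                    ≡⟨ cong (_% m) (place-row s s<k v win) ⟩
      (toℕ i + s * m) % m      ≡⟨ block-offset s (toℕ<n i) ⟩
      toℕ i                    ∎)
      where open ≡-Reasoning
    same-col : r / m * stride + toℕ (proj₂ (place s s<k v win)) ≡ toℕ j
    same-col = begin
      r / m * stride + toℕ (proj₂ (place s s<k v win))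
        ≡⟨ cong₂ (λ q c → q * stride + c)
             (trans (cong (_/ m) (place-row s s<k v win)) (block-index s (toℕ<n i)))
             (place-col s s<k v win) ⟩
      s * stride + (toℕ j ∸ s * stride) ≡⟨ m+[n∸m]≡n lo ⟩
      toℕ j                             ∎
      where open ≡-Reasoning

  -- Copies of two vertices in the same block are adjacent iff the vertices are,
  -- since both coordinates are shifted by the same amount.
  place-adj : ∀ s s<k v w winv winw → Adj {m} {n₁} v w →
    Adj {m₂} {n₂} (place s s<k v winv) (place s s<k w winw)
  place-adj s s<k v@(i₁ , j₁) w@(i₂ , j₂) winv@(lo₁ , _) winw@(lo₂ , _) adj =
    trans (cong₂ _+_ rows cols) adj
    where
    rows : ∣ toℕ (proj₁ (place s s<k v winv)) - toℕ (proj₁ (place s s<k w winw)) ∣ ≡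
           ∣ toℕ i₁ - toℕ i₂ ∣
    rows = trans (cong₂ ∣_-_∣ (place-row s s<k v winv) (place-row s s<k w winw))
                 (dist-+ʳ (s * m) (toℕ i₁) (toℕ i₂))
    cols : ∣ toℕ (proj₂ (place s s<k v winv)) - toℕ (proj₂ (place s s<k w winw)) ∣ ≡
           ∣ toℕ j₁ - toℕ j₂ ∣
    cols = trans (cong₂ ∣_-_∣ (place-col s s<k v winv) (place-col s s<k w winw))
                 (dist-∸ (s * stride) (toℕ j₁) (toℕ j₂) lo₁ lo₂)

  stacked-simulates : Simulates c₁ stacked
  stacked-simulates v@(_ , j₁) w@(_ , j₂) adj
    with window-covers n₁ k′ n₂ windows-cover (column-gap v w adj) (toℕ<n j₁) (toℕ<n j₂)
  ... | s , s<k , winv , winw =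
    place s s<k v winv , place s s<k w winw , place-adj s s<k v w winv winw adj ,
    stacked-place s s<k v winv , stacked-place s s<k w winw

lemma3 : (k₀ m₁ n₁ m₂ n₂ : ℕ) (A : Fin k₀ → Fin k₀ → Set)
    (c₁ : PartialColoring k₀ m₁ n₁) → RealizesAll c₁ A →
    (∃[ k ] (1 ≤ k × k * m₁ ≤ m₂ × n₁ + (k ∸ 1) ≤ k * n₂)) →
    Σ (PartialColoring k₀ m₂ n₂) (λ c₂ → RealizesAll c₂ A)
lemma3 k₀ zero n₁ m₂ n₂ A c₁ realized _ =
  uncoloured , simulates-realizesAll A (rowless-simulated c₁ uncoloured) realized
  where
  uncoloured : PartialColoring k₀ m₂ n₂
  uncoloured _ = nothing
lemma3 k₀ (suc m′) n₁ m₂ n₂ A c₁ realized (suc k′ , _ , rows-fit , windows-cover) =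
  stacked , simulates-realizesAll A stacked-simulates realized
  where open Stacking k′ c₁ rows-fit windows-cover
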